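{- Let $A$ be a set of $n$ positive integers. Then $d(A)\le 2^{n-1}+h$, where $h$ is the number of abundant separations of $A$.
   Context: For a finite set $A$ of positive integers, write $\sum A$ for the sum of its elements (with $\sum\emptyset=0$). A subset $B\subseteq A$ is a divisor of $A$ if $\sum B$ divides $\sum A$ (the empty set is not a divisor of nonempty $A$); $d(A)$ is the number of divisors of $A$. A separation of $A$ is an unordered pair $\{B,C\}$ of disjoint subsets of $A$ with $B\cup C=A$. A separation $\{B,C\}$ is abundant if both $B$ and $C$ are divisors of $A$. -}

module Defs where

open import Data.Nat using (ℕ; zero; suc; _+_; _*_; _/_)
open import Data.Nat.Divisibility using (_∣_; _∣?_)
open import Data.Bool using (Bool; true; false)
open import Data.Vec using (Vec; []; _∷_)
open import Data.List using (List; []; _∷_; map; _++_; filter; length)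
open import Data.Fin.Subset using (Subset; ∁; outside; inside)
open import Data.Product using (_×_)
open import Relation.Nullary.Decidable using (_×-dec_)
open import Relation.Binary.PropositionalEquality using (_≡_)
import Data.Vec.Properties as VecP
import Data.Bool.Properties as BoolP

-- A finite set of n positive integers is a vector A of length n with pairwise
-- distinct positive entries; a subset B ⊆ A is given by a characteristic
-- vector B : Subset n (inside = element of B).

subsetSum : ∀ {n} → Vec ℕ n → Subset n → ℕ
subsetSum []       []           = 0
subsetSum (a ∷ as) (true  ∷ bs) = a + subsetSum as bs
subsetSum (a ∷ as) (false ∷ bs) = subsetSum as bs

total : ∀ {n} → Vec ℕ n → ℕ
total []       = 0
total (a ∷ as) = a + total as

allSubsets : (n : ℕ) → List (Subset n)
allSubsets zero    = [] ∷ []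
allSubsets (suc n) = map (true ∷_) (allSubsets n) ++ map (false ∷_) (allSubsets n)

-- B is a divisor of A : ∑ B divides ∑ A.  (With ∑ ∅ = 0 and 0 ∣ m ⇔ m ≡ 0,
-- the empty set is automatically not a divisor of a nonempty A of positive integers.)
IsDivisor : ∀ {n} → Vec ℕ n → Subset n → Set
IsDivisor A B = subsetSum A B ∣ total A

d : ∀ {n} → Vec ℕ n → ℕ
d {n} A = length (filter (λ B → subsetSum A B ∣? total A) (allSubsets n))

-- A separation {B, C} of A is determined by B with C = ∁ B.  It is abundant iff
-- both B and ∁ B are divisors.  Ordered count of such B:
abundantOrdered : ∀ {n} → Vec ℕ n → ℕ
abundantOrdered {n} A =
  length (filter (λ B → (subsetSum A B ∣? total A) ×-dec (subsetSum A (∁ B) ∣? total A))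
                 (allSubsets n))

-- Number of abundant ordered separations (B , ∁ B) with B ≡ ∁ B
-- (only possible when n = 0); these give unordered pairs {B,B} counted once.
abundantSelfComplementary : ∀ {n} → Vec ℕ n → ℕ
abundantSelfComplementary {n} A =
  length (filter (λ B → ((subsetSum A B ∣? total A) ×-dec (subsetSum A (∁ B) ∣? total A))
                          ×-dec VecP.≡-dec BoolP._≟_ B (∁ B))
                 (allSubsets n))

-- h(A) : number of abundant (unordered) separations of A.
-- Each unordered pair {B, ∁ B} with B ≢ ∁ B arises from exactly two ordered ones.
abundantSeparations : ∀ {n} → Vec ℕ n → ℕ
abundantSeparations A = (abundantOrdered A + abundantSelfComplementary A) / 2

-- Pairing each subset B with its complement ∁ B, the indicators of "B is a divisor" and
-- "∁ B is a divisor" add up to at most 1 + [both are divisors].  Summing over all 2ⁿ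
-- subsets, and using that B ↦ ∁ B permutes them, gives 2 d(A) ≤ 2ⁿ + (number of B with
-- {B, ∁ B} abundant), and halving yields the bound.
module Submission where

open import Defs
open import Data.Nat using (ℕ; zero; suc; _≤_; _<_; _+_; _∸_; _*_; _/_; _^_; z≤n; s≤s)
open import Data.Nat.Properties
open import Data.Nat.DivMod using (/-monoˡ-≤; +-distrib-/-∣ˡ; m*n/n≡m)
open import Data.Nat.Divisibility using (_∣?_; divides-refl)
open import Data.Bool using (true; false)
open import Data.Vec using (Vec; []; _∷_)
open import Data.Vec.Relation.Unary.All using (All)
open import Data.Vec.Relation.Unary.Unique.Propositional using (Unique)
open import Data.List using (List; []; _∷_; map; _++_; filter; length)
open import Data.List.Properties using (length-++; length-map; filter-++)
open import Data.Fin.Subset using (Subset; ∁)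
open import Relation.Nullary using (does; yes; no)
open import Relation.Unary using (Pred; Decidable)
open import Relation.Unary.Properties using (_∩?_)
open import Relation.Binary.PropositionalEquality
open import Function using (_∘_)
open import Level using (Level)

private
  variable
    a ℓ₁ ℓ₂ : Level
    X Y : Set a

module _ {P : Pred X ℓ₁} (P? : Decidable P) where

  length-filter-++ : ∀ xs ys →
    length (filter P? (xs ++ ys)) ≡ length (filter P? xs) + length (filter P? ys)
  length-filter-++ xs ys = trans (cong length (filter-++ P? xs ys)) (length-++ (filter P? xs))

  length-filter-map : (f : Y → X) (ys : List Y) →
    length (filter P? (map f ys)) ≡ length (filter (P? ∘ f) ys)
  length-filter-map f []       = refl
  length-filter-map f (y ∷ ys) with does (P? (f y))
  ... | true  = cong suc (length-filter-map f ys)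
  ... | false = length-filter-map f ys

  length-filter-+-≤ : {Q : Pred X ℓ₂} (Q? : Decidable Q) (xs : List X) →
    length (filter P? xs) + length (filter Q? xs) ≤ length xs + length (filter (P? ∩? Q?) xs)
  length-filter-+-≤ Q? []       = z≤n
  length-filter-+-≤ Q? (x ∷ xs) with ih ← length-filter-+-≤ Q? xs | P? x | Q? x
  ... | yes _ | yes _ = s≤s (subst₂ _≤_ (sym (+-suc _ _)) (sym (+-suc _ _)) (s≤s ih))
  ... | yes _ | no  _ = s≤s ih
  ... | no  _ | yes _ = ≤-trans (≤-reflexive (+-suc _ _)) (s≤s ih)
  ... | no  _ | no  _ = m≤n⇒m≤1+n ih

length-allSubsets : ∀ n → length (allSubsets n) ≡ 2 ^ n
length-allSubsets zero    = refl
length-allSubsets (suc n) = begin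
  length (map (true ∷_) L ++ map (false ∷_) L)     ≡⟨ length-++ (map (true ∷_) L) ⟩
  length (map (true ∷_) L) + length (map (false ∷_) L)
    ≡⟨ cong₂ _+_ (length-map (true ∷_) L) (length-map (false ∷_) L) ⟩
  length L + length L                              ≡⟨ cong (λ m → m + m) (length-allSubsets n) ⟩
  2 ^ n + 2 ^ n                                    ≡⟨ cong (2 ^ n +_) (sym (+-identityʳ (2 ^ n))) ⟩
  2 ^ suc n                                        ∎
  where
  open ≡-Reasoning
  L = allSubsets n

length-filter-∁-allSubsets : ∀ n {P : Pred (Subset n) ℓ₁} (P? : Decidable P) →
  length (filter (P? ∘ ∁) (allSubsets n)) ≡ length (filter P? (allSubsets n))
-- The case split unblocks filter, which is stuck on does (P? []).
length-filter-∁-allSubsets zero    P? with does (P? [])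
... | true  = refl
... | false = refl
length-filter-∁-allSubsets (suc n) P? = begin
  length (filter (P? ∘ ∁) (map (true ∷_) L ++ map (false ∷_) L))
    ≡⟨ length-filter-++ (P? ∘ ∁) (map (true ∷_) L) (map (false ∷_) L) ⟩
  length (filter (P? ∘ ∁) (map (true ∷_) L)) + length (filter (P? ∘ ∁) (map (false ∷_) L))
    ≡⟨ cong₂ _+_ (length-filter-map (P? ∘ ∁) (true ∷_) L) (length-filter-map (P? ∘ ∁) (false ∷_) L) ⟩
  length (filter (P?ᶠ ∘ ∁) L) + length (filter (P?ᵗ ∘ ∁) L)
    ≡⟨ cong₂ _+_ (length-filter-∁-allSubsets n P?ᶠ) (length-filter-∁-allSubsets n P?ᵗ) ⟩
  length (filter P?ᶠ L) + length (filter P?ᵗ L)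
    ≡⟨ +-comm (length (filter P?ᶠ L)) _ ⟩
  length (filter P?ᵗ L) + length (filter P?ᶠ L)
    ≡⟨ sym (cong₂ _+_ (length-filter-map P? (true ∷_) L) (length-filter-map P? (false ∷_) L)) ⟩
  length (filter P? (map (true ∷_) L)) + length (filter P? (map (false ∷_) L))
    ≡⟨ sym (length-filter-++ P? (map (true ∷_) L) (map (false ∷_) L)) ⟩
  length (filter P? (map (true ∷_) L ++ map (false ∷_) L)) ∎
  where
  open ≡-Reasoning
  L = allSubsets n
  P?ᵗ = P? ∘ (true ∷_)
  P?ᶠ = P? ∘ (false ∷_)

d+d≤2^n+abundantOrdered : ∀ {n} (A : Vec ℕ n) → d A + d A ≤ 2 ^ n + abundantOrdered A
d+d≤2^n+abundantOrdered {n} A = begin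
  d A + d A
    ≡⟨ cong (d A +_) (sym (length-filter-∁-allSubsets n divisor?)) ⟩
  length (filter divisor? L) + length (filter (divisor? ∘ ∁) L)
    ≤⟨ length-filter-+-≤ divisor? (divisor? ∘ ∁) L ⟩
  length L + abundantOrdered A
    ≡⟨ cong (_+ abundantOrdered A) (length-allSubsets n) ⟩
  2 ^ n + abundantOrdered A ∎
  where
  open ≤-Reasoning
  L = allSubsets n
  divisor? : Decidable (IsDivisor A)
  divisor? B = subsetSum A B ∣? total A

2^n≤2^[n∸1]+2^[n∸1] : ∀ n → 2 ^ n ≤ 2 ^ (n ∸ 1) + 2 ^ (n ∸ 1)
2^n≤2^[n∸1]+2^[n∸1] zero    = s≤s z≤n
2^n≤2^[n∸1]+2^[n∸1] (suc n) = ≤-reflexive (cong (2 ^ n +_) (+-identityʳ (2 ^ n)))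

m+m≤k+k+l⇒m≤k+l/2 : ∀ {m} k l → m + m ≤ k + k + l → m ≤ k + l / 2
m+m≤k+k+l⇒m≤k+l/2 {m} k l m+m≤k+k+l = begin
  m                 ≡⟨ m*n/n≡m m 2 ⟨
  m * 2 / 2         ≤⟨ /-monoˡ-≤ 2 (subst₂ _≤_ (m+m≡m*2 m) (cong (_+ l) (m+m≡m*2 k)) m+m≤k+k+l) ⟩
  (k * 2 + l) / 2   ≡⟨ +-distrib-/-∣ˡ l (divides-refl k) ⟩
  k * 2 / 2 + l / 2 ≡⟨ cong (_+ l / 2) (m*n/n≡m k 2) ⟩
  k + l / 2         ∎
  where
  open ≤-Reasoning
  m+m≡m*2 : ∀ x → x + x ≡ x * 2
  m+m≡m*2 x = trans (cong (x +_) (sym (+-identityʳ x))) (*-comm 2 x)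

-- Positivity and distinctness of the entries are not needed.
mainTheorem8 : (n : ℕ) (A : Vec ℕ n) → All (0 <_) A → Unique A →
    d A ≤ 2 ^ (n ∸ 1) + abundantSeparations A
mainTheorem8 n A _ _ = m+m≤k+k+l⇒m≤k+l/2 (2 ^ (n ∸ 1)) _ (begin
  d A + d A                                    ≤⟨ d+d≤2^n+abundantOrdered A ⟩
  2 ^ n + abundantOrdered A                    ≤⟨ +-mono-≤ (2^n≤2^[n∸1]+2^[n∸1] n) (m≤m+n _ _) ⟩
  2 ^ (n ∸ 1) + 2 ^ (n ∸ 1) + (abundantOrdered A + abundantSelfComplementary A) ∎)
  where open ≤-Reasoning
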